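{- Let $R$ be a commutative ring, $m$ a positive integer, and let $(h_n)_{n>0}$ and $(h'_n)_{n>0}$ be two sequences in $R$ that both satisfy $$E(n,2,1,0):\quad h_{n+2}h_{n-2}h_1^2=h_2^2h_{n+1}h_{n-1}-h_3h_1h_n^2$$ for all integers $3\le n\le m-2$. Suppose $h_n=h'_n$ for $1\le n\le 4$, and $h_n$ is not a zero-divisor for any $1\le n\le m-4$. Then $h_n=h'_n$ for all $1\le n\le m$. -}

module Defs where

open import Level using (Level; _⊔_)
open import Data.Nat using (ℕ; suc; _∸_)
open import Algebra.Bundles using (CommutativeRing)

-- Sequences (h_n)_{n>0} in R are modelled as functions ℕ → Carrier;
-- the value at 0 is never used (all hypotheses/conclusions concern n ≥ 1).

module _ {c ℓ : Level} (R : CommutativeRing c ℓ) where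
  open CommutativeRing R

  -- The relation E(n,2,1,0) at index n (used only for n ≥ 3, so that
  -- the truncated subtractions n ∸ 1, n ∸ 2 are the true n-1, n-2):
  --   h(n+2) h(n-2) h(1)^2 = h(2)^2 h(n+1) h(n-1) - h(3) h(1) h(n)^2
  E2,1,0 : (ℕ → Carrier) → ℕ → Set ℓ
  E2,1,0 h n =
    h (suc (suc n)) * h (n ∸ 2) * (h 1 * h 1)
      ≈ (h 2 * h 2) * h (suc n) * h (n ∸ 1) - h 3 * h 1 * (h n * h n)

  NonZeroDivisor : Carrier → Set (c ⊔ ℓ)
  NonZeroDivisor a = ∀ x → a * x ≈ 0# → x ≈ 0#

{-# OPTIONS --safe #-}
-- Both sequences obey the same recurrence, solved for its top term:
-- h(k+5) · h(k+1) h(1)² is a polynomial in h(1), h(2), h(3), h(k+2), h(k+3), h(k+4).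
-- Cancelling the non-zero-divisor h(k+1) h(1)² shows that agreement on 1, …, k+4
-- propagates to k+5, and induction from the four given initial values does the rest.
module Submission where

open import Defs
open import Level using (Level)
open import Data.Nat using (ℕ; zero; suc; _∸_; _≤_; _≤?_; z≤n; s≤s)
open import Data.Nat.Properties
  using (≤-trans; ≤-total; ≤-reflexive; <⇒≤; ∸-monoˡ-≤; m≤m+n; +-monoˡ-≤; m≤n⇒m<n∨m≡n; m+[n∸m]≡n)
open import Data.Sum using (inj₁; inj₂)
open import Relation.Nullary.Decidable using (True; toWitness)
open import Relation.Binary.PropositionalEquality using (refl; subst)
open import Algebra.Bundles using (CommutativeRing)
import Algebra.Properties.Group as GroupProperties
import Algebra.Properties.Ring as RingProperties
import Relation.Binary.Reasoning.Setoid as SetoidReasoning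

module _ {c ℓ : Level} (R : CommutativeRing c ℓ) where
  open CommutativeRing R
  open GroupProperties +-group using (x∙y⁻¹≈ε⇒x≈y)
  open RingProperties ring using (-‿distribˡ-*)
  open SetoidReasoning setoid

  nonZeroDivisor-* : ∀ {a b} → NonZeroDivisor R a → NonZeroDivisor R b →
                     NonZeroDivisor R (a * b)
  nonZeroDivisor-* {a} {b} nzd-a nzd-b x abx≈0 =
    nzd-b x (nzd-a (b * x) (trans (sym (*-assoc a b x)) abx≈0))

  *-cancelʳ-nonZeroDivisor : ∀ {x x′ y} → NonZeroDivisor R y →
                             x * y ≈ x′ * y → x ≈ x′
  *-cancelʳ-nonZeroDivisor {x} {x′} {y} nzd-y xy≈x′y =
    x∙y⁻¹≈ε⇒x≈y x x′ (nzd-y (x - x′) (begin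
      y * (x - x′)          ≈⟨ *-comm y (x - x′) ⟩
      (x - x′) * y          ≈⟨ distribʳ y x (- x′) ⟩
      x * y + - x′ * y      ≈⟨ +-cong xy≈x′y (sym (-‿distribˡ-* x′ y)) ⟩
      x′ * y - x′ * y       ≈⟨ -‿inverseʳ (x′ * y) ⟩
      0#                    ∎))

module _ {c ℓ : Level} (R : CommutativeRing c ℓ) where
  open CommutativeRing R hiding (_+_)
  open import Data.Nat using (_+_)
  open SetoidReasoning setoid

  AgreeUpTo : (h h′ : ℕ → Carrier) → ℕ → Set ℓ
  AgreeUpTo h h′ n = ∀ k → 1 ≤ k → k ≤ n → h k ≈ h′ k

  module _ {h h′ : ℕ → Carrier} where

    AgreeUpTo-mono : ∀ {m n} → m ≤ n → AgreeUpTo h h′ n → AgreeUpTo h h′ m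
    AgreeUpTo-mono m≤n agree k 1≤k k≤m = agree k 1≤k (≤-trans k≤m m≤n)

    AgreeUpTo-suc : ∀ {n} → AgreeUpTo h h′ n → h (suc n) ≈ h′ (suc n) →
                    AgreeUpTo h h′ (suc n)
    AgreeUpTo-suc agree eq k 1≤k k≤1+n with m≤n⇒m<n∨m≡n k≤1+n
    ... | inj₁ (s≤s k≤n) = agree k 1≤k k≤n
    ... | inj₂ refl      = eq

    E2,1,0-determines-next : ∀ k → AgreeUpTo h h′ (4 + k) →
      E2,1,0 R h (3 + k) → E2,1,0 R h′ (3 + k) →
      NonZeroDivisor R (h 1) → NonZeroDivisor R (h (1 + k)) →
      h (5 + k) ≈ h′ (5 + k)
    E2,1,0-determines-next k agree E E′ nzd-h₁ nzd-hₖ₊₁ =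
      *-cancelʳ-nonZeroDivisor R (nonZeroDivisor-* R nzd-hₖ₊₁ (nonZeroDivisor-* R nzd-h₁ nzd-h₁))
        (begin
          h (5 + k) * (h (1 + k) * (h 1 * h 1))
            ≈⟨ sym (*-assoc _ _ _) ⟩
          h (5 + k) * h (1 + k) * (h 1 * h 1)
            ≈⟨ E ⟩
          (h 2 * h 2) * h (4 + k) * h (2 + k) - h 3 * h 1 * (h (3 + k) * h (3 + k))
            ≈⟨ +-cong (*-cong (*-cong (*-cong (initial 2) (initial 2)) (recent 3)) (recent 1))
                      (-‿cong (*-cong (*-cong (initial 3) (initial 1)) (*-cong (recent 2) (recent 2)))) ⟩
          (h′ 2 * h′ 2) * h′ (4 + k) * h′ (2 + k) - h′ 3 * h′ 1 * (h′ (3 + k) * h′ (3 + k))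
            ≈⟨ sym E′ ⟩
          h′ (5 + k) * h′ (1 + k) * (h′ 1 * h′ 1)
            ≈⟨ *-cong (*-congˡ (sym (recent 0))) (sym (*-cong (initial 1) (initial 1))) ⟩
          h′ (5 + k) * h (1 + k) * (h 1 * h 1)
            ≈⟨ *-assoc _ _ _ ⟩
          h′ (5 + k) * (h (1 + k) * (h 1 * h 1))
            ∎)
      where
      initial : ∀ i {1≤i : True (1 ≤? i)} {i≤4 : True (i ≤? 4)} → h i ≈ h′ i
      initial i {1≤i} {i≤4} = agree i (toWitness 1≤i) (≤-trans (toWitness i≤4) (m≤m+n 4 k))

      recent : ∀ j {j≤3 : True (j ≤? 3)} → h (suc j + k) ≈ h′ (suc j + k)
      recent j {j≤3} = agree (suc j + k) (s≤s z≤n) (+-monoˡ-≤ k (s≤s (toWitness j≤3)))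

    AgreeUpTo-propagate : ∀ m →
      (∀ n → 3 ≤ n → n ≤ m ∸ 2 → E2,1,0 R h n) →
      (∀ n → 3 ≤ n → n ≤ m ∸ 2 → E2,1,0 R h′ n) →
      (∀ n → 1 ≤ n → n ≤ m ∸ 4 → NonZeroDivisor R (h n)) →
      AgreeUpTo h h′ 4 → ∀ k → 4 + k ≤ m → AgreeUpTo h h′ (4 + k)
    AgreeUpTo-propagate m E E′ nzd agree≤4 = go
      where
      go : ∀ k → 4 + k ≤ m → AgreeUpTo h h′ (4 + k)
      go zero    _      = agree≤4
      go (suc k) 5+k≤m  = AgreeUpTo-suc agree≤4+k
        (E2,1,0-determines-next k agree≤4+k
          (E (3 + k) 3≤3+k (∸-monoˡ-≤ 2 5+k≤m))
          (E′ (3 + k) 3≤3+k (∸-monoˡ-≤ 2 5+k≤m))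
          (nzd 1 (s≤s z≤n) (≤-trans (s≤s z≤n) 1+k≤m∸4))
          (nzd (1 + k) (s≤s z≤n) 1+k≤m∸4))
        where
        agree≤4+k = go k (<⇒≤ 5+k≤m)
        3≤3+k     = s≤s (s≤s (s≤s z≤n))
        1+k≤m∸4   = ∸-monoˡ-≤ 4 5+k≤m

proposition3p1 : ∀ {c ℓ : Level} (R : CommutativeRing c ℓ) (m : ℕ) → 1 ≤ m →
    (h h′ : ℕ → CommutativeRing.Carrier R) →
    (∀ n → 3 ≤ n → n ≤ m ∸ 2 → E2,1,0 R h n) →
    (∀ n → 3 ≤ n → n ≤ m ∸ 2 → E2,1,0 R h′ n) →
    (∀ n → 1 ≤ n → n ≤ 4 → CommutativeRing._≈_ R (h n) (h′ n)) →
    (∀ n → 1 ≤ n → n ≤ m ∸ 4 → NonZeroDivisor R (h n)) →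
    ∀ n → 1 ≤ n → n ≤ m → CommutativeRing._≈_ R (h n) (h′ n)
proposition3p1 R m _ h h′ E E′ agree≤4 nzd with ≤-total 4 m
... | inj₂ m≤4 = AgreeUpTo-mono R m≤4 agree≤4
... | inj₁ 4≤m = subst (AgreeUpTo R h h′) (m+[n∸m]≡n 4≤m)
                   (AgreeUpTo-propagate R m E E′ nzd agree≤4 (m ∸ 4) (≤-reflexive (m+[n∸m]≡n 4≤m)))
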